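{- If a finite graph $G$ has no loops, then $$\mu(\emptyset,G)=\begin{cases}1,&|G|=0,\\-1,&|G|=1,\\0,&|G|>1,\end{cases}$$ where $\emptyset$ is the null graph (with no vertices).
   Context: $\mathcal{G}$ is the poset of all finite unlabelled graphs (loops and multiple edges allowed, including the null graph with no vertices), up to isomorphism, with $H\le G$ iff $H$ is isomorphic to an induced subgraph of $G$; $|G|$ is the number of vertices; $\mu$ is its Möbius function ($\mu(a,a)=1$, $\mu(a,b)=0$ if $a\not\le b$, $\mu(a,b)=-\sum_{a\le c<b}\mu(a,c)$ if $a<b$). -}

module Defs where

open import Data.Nat using (ℕ; zero; suc)
open import Data.Fin using (Fin)
open import Data.Integer using (ℤ; _+_; -_) renaming (0ℤ to z0; 1ℤ to z1; -1ℤ to zm1)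
open import Data.List using (List; foldr; map)
open import Data.List.Relation.Unary.All using (All)
open import Data.List.Relation.Unary.Any using (Any)
open import Data.List.Relation.Unary.AllPairs using (AllPairs)
open import Data.Product using (Σ; _×_)
open import Function.Definitions using (Injective; Bijective)
open import Relation.Binary.PropositionalEquality using (_≡_)
open import Relation.Nullary using (¬_)

-- A finite graph with loops and multiple edges allowed:
-- vertex set Fin size, adj i j = number of edges between i and j
-- (adj i i = number of loops at i), symmetric.
record Graph : Set where
  field
    size : ℕ
    adj  : Fin size → Fin size → ℕ
    sym  : ∀ i j → adj i j ≡ adj j i
open Graph public

nullGraph : Graph
nullGraph = record { size = 0 ; adj = λ () ; sym = λ () }

Loopless : Graph → Set
Loopless G = ∀ i → adj G i i ≡ 0

-- H ≤ G : H is isomorphic to an induced subgraph of G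
-- (an injective vertex map preserving all edge multiplicities).
_≼_ : Graph → Graph → Set
H ≼ G = Σ (Fin (size H) → Fin (size G)) λ f →
          Injective _≡_ _≡_ f × (∀ i j → adj H i j ≡ adj G (f i) (f j))

-- Graph isomorphism (equality in the poset of unlabelled graphs).
_≅_ : Graph → Graph → Set
H ≅ G = Σ (Fin (size H) → Fin (size G)) λ f →
          Bijective _≡_ _≡_ f × (∀ i j → adj H i j ≡ adj G (f i) (f j))

_≺_ : Graph → Graph → Set
H ≺ G = H ≼ G × ¬ (G ≼ H)

sumℤ : List ℤ → ℤ
sumℤ = foldr _+_ z0

-- L is a system of representatives of the isomorphism classes c with c < G:
-- every member is < G, members are pairwise non-isomorphic, and every
-- H < G is isomorphic to a member.
StrictLowerClasses : Graph → List Graph → Set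
StrictLowerClasses G L =
  All (λ H → H ≺ G) L × AllPairs (λ A B → ¬ (A ≅ B)) L ×
  (∀ H → H ≺ G → Any (λ K → H ≅ K) L)

-- m is the Möbius function μ(∅, -) of the poset 𝒢 (as a function on
-- representatives): μ(∅,∅) = 1 and, for ∅ < G,
-- μ(∅,G) = - Σ_{∅ ≤ c < G} μ(∅,c)   (sum over isomorphism classes).
-- (Every graph is ≥ ∅, and ∅ < G iff size G ≥ 1.)
IsMobiusFromNull : (Graph → ℤ) → Set
IsMobiusFromNull m =
  (m nullGraph ≡ z1) ×
  (∀ G → nullGraph ≺ G → ∀ L → StrictLowerClasses G L → m G ≡ - sumℤ (map m L))

caseValue : ℕ → ℤ
caseValue zero = z1
caseValue (suc zero) = zm1
caseValue (suc (suc _)) = z0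

-- Every graph below a loopless G is loopless, so by induction μ(∅,c) is
-- 1, -1 or 0 according as |c| is 0, 1 or larger, for every class c < G.  The defining
-- recursion therefore gives μ(∅,G) = -(a₀ - a₁), where a₀ = 1 counts the null class and a₁
-- counts the one-vertex loopless classes below G: there is only one such class, and it lies
-- below G exactly when |G| ≥ 2.
--
-- The recursion is stated for every list of representatives of the classes below G, so such a
-- list has to be produced: every graph below G is isomorphic to an induced subgraph along some
-- map Fin k → Fin |G| with k < |G|, and embeddability is decidable because there are finitely
-- many such maps, so filtering and deduplicating the induced subgraphs up to isomorphism gives one.
module Submission where

open import Defs
open import Relation.Binary.PropositionalEquality using (_≡_)
open import Data.Integer using (ℤ)

open import Data.Empty using (⊥-elim)
open import Data.Fin using (Fin; zero; suc; punchOut; fromℕ<)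
open import Data.Fin.Properties using (injective⇒≤; punchOut-injective; ¬Fin0; any?; all?)
  renaming (_≟_ to _≟ᶠ_)
open import Data.Integer using (_+_; _-_; -_; +_; 0ℤ; 1ℤ; -1ℤ)
open import Data.Integer.Tactic.RingSolver using (solve-∀)
open import Data.List using (List; []; _∷_; map; filter; length; concatMap; deduplicate; upTo; allFin)
open import Data.List.Properties using (map-cong-local; filter-none; filter-some)
open import Data.List.Membership.Propositional using (lose)
open import Data.List.Membership.Propositional.Properties using (∈-allFin; ∈-upTo⁺)
open import Data.List.Relation.Unary.All as All using (All; []; _∷_)
import Data.List.Relation.Unary.All.Properties as All
open import Data.List.Relation.Unary.Any as Any using (Any; here)
import Data.List.Relation.Unary.Any.Properties as Any
open import Data.List.Relation.Unary.AllPairs using (AllPairs; []; _∷_)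
import Data.List.Relation.Unary.Unique.DecSetoid.Properties as Unique
import Data.Integer.Properties as ℤ
open import Data.Nat using (ℕ; zero; suc; _<_; _≤_; z≤n; s≤s; _≟_)
open import Data.Nat.Induction using (<-rec)
open import Data.Nat.Properties
  using (≤-antisym; ≤-reflexive; <-trans; <⇒≱; <⇒≤; 1+n≰n; m≤n⇒m<n∨m≡n; n<1⇒n≡0)
open import Data.Product using (∃; _×_; _,_; proj₁; proj₂)
open import Data.Sum using (inj₁; inj₂; [_,_]′)
import Data.Vec.Functional as Vector
open import Function using (_∘_)
open import Function.Consequences.Propositional using (strictlySurjective⇒surjective)
open import Function.Definitions using (Injective; StrictlySurjective)
open import Relation.Binary using (Decidable; DecSetoid)
open import Relation.Binary.PropositionalEquality
  using (module ≡-Reasoning; refl; trans; cong; cong₂; subst; subst₂; _≗_; _≢_)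
  renaming (sym to ≡-sym)
open import Relation.Nullary using (¬_; Dec; yes; no; contradiction; ¬?)
open import Relation.Nullary.Decidable using (map′; _×-dec_; _→-dec_)
open import Relation.Unary using (∁)

injective⇒strictlySurjective : ∀ {m n} {f : Fin m → Fin n} →
  m ≡ n → Injective _≡_ _≡_ f → StrictlySurjective _≡_ f
injective⇒strictlySurjective {suc m} {f = f} refl f-inj y with any? (λ x → f x ≟ᶠ y)
... | yes hit = hit
... | no miss = contradiction (injective⇒≤ {f = squeeze} squeeze-inj) 1+n≰n
  where
  avoids : ∀ x → y ≢ f x
  avoids x y≡fx = miss (x , ≡-sym y≡fx)
  squeeze : Fin (suc m) → Fin m
  squeeze x = punchOut (avoids x)
  squeeze-inj : Injective _≡_ _≡_ squeeze
  squeeze-inj {a} {b} eq = f-inj (punchOut-injective (avoids a) (avoids b) eq)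

≼-trans : ∀ {A B C} → A ≼ B → B ≼ C → A ≼ C
≼-trans (f , f-inj , f-adj) (g , g-inj , g-adj) =
  g ∘ f , f-inj ∘ g-inj , λ i j → trans (f-adj i j) (g-adj (f i) (f j))

≼⇒size≤ : ∀ {H G} → H ≼ G → size H ≤ size G
≼⇒size≤ (f , f-inj , _) = injective⇒≤ {f = f} f-inj

≼-invert : ∀ {H G} (e : H ≼ G) → StrictlySurjective _≡_ (proj₁ e) → G ≼ H
≼-invert {H} {G} (f , f-inj , f-adj) surj = g , g-inj , g-adj
  where
  g : Fin (size G) → Fin (size H)
  g y = proj₁ (surj y)
  fg : ∀ y → f (g y) ≡ y
  fg y = proj₂ (surj y)
  g-inj : Injective _≡_ _≡_ g
  g-inj {x} {y} gx≡gy = trans (≡-sym (fg x)) (trans (cong f gx≡gy) (fg y))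
  g-adj : ∀ i j → adj G i j ≡ adj H (g i) (g j)
  g-adj i j = ≡-sym (trans (f-adj (g i) (g j)) (cong₂ (adj G) (fg i) (fg j)))

≼⇒≅ : ∀ {H G} → H ≼ G → size H ≡ size G → H ≅ G
≼⇒≅ (f , f-inj , f-adj) eq =
  f , (f-inj , strictlySurjective⇒surjective (injective⇒strictlySurjective eq f-inj)) , f-adj

≅⇒≼ : ∀ {H G} → H ≅ G → H ≼ G
≅⇒≼ (f , (f-inj , _) , f-adj) = f , f-inj , f-adj

≅⇒≽ : ∀ {H G} → H ≅ G → G ≼ H
≅⇒≽ {H} {G} (f , (f-inj , surj) , f-adj) =
  ≼-invert {H} {G} (f , f-inj , f-adj) λ y → proj₁ (surj y) , proj₂ (surj y) refl

≅⇒size≡ : ∀ {H G} → H ≅ G → size H ≡ size G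
≅⇒size≡ {H} {G} H≅G =
  ≤-antisym (≼⇒size≤ {H} {G} (≅⇒≼ {H} {G} H≅G)) (≼⇒size≤ {G} {H} (≅⇒≽ {H} {G} H≅G))

≅-refl : ∀ {G} → G ≅ G
≅-refl = (λ i → i) , ((λ eq → eq) , λ y → y , λ eq → eq) , λ _ _ → refl

≅-sym : ∀ {H G} → H ≅ G → G ≅ H
≅-sym {H} {G} H≅G = ≼⇒≅ {G} {H} (≅⇒≽ {H} {G} H≅G) (≡-sym (≅⇒size≡ {H} {G} H≅G))

≅-trans : ∀ {A B C} → A ≅ B → B ≅ C → A ≅ C
≅-trans {A} {B} {C} A≅B B≅C =
  ≼⇒≅ {A} {C} (≼-trans {A} {B} {C} (≅⇒≼ {A} {B} A≅B) (≅⇒≼ {B} {C} B≅C))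
      (trans (≅⇒size≡ {A} {B} A≅B) (≅⇒size≡ {B} {C} B≅C))

≺⇒size< : ∀ {H G} → H ≺ G → size H < size G
≺⇒size< {H} {G} (H≼G , G⋠H) with m≤n⇒m<n∨m≡n (≼⇒size≤ {H} {G} H≼G)
... | inj₁ lt = lt
... | inj₂ eq = contradiction (≅⇒≽ {H} {G} (≼⇒≅ {H} {G} H≼G eq)) G⋠H

≼∧size<⇒≺ : ∀ {H G} → H ≼ G → size H < size G → H ≺ G
≼∧size<⇒≺ {H} {G} H≼G lt = H≼G , λ G≼H → <⇒≱ lt (≼⇒size≤ {G} {H} G≼H)

Loopless-≼ : ∀ {H G} → H ≼ G → Loopless G → Loopless H
Loopless-≼ (f , _ , f-adj) G-loopless i = trans (f-adj i i) (G-loopless (f i))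

vertexless-≼ : ∀ {H} G → size H ≡ 0 → H ≼ G
vertexless-≼ G eq = (λ i → ⊥-elim (¬Fin0 (subst Fin eq i)))
                  , (λ {i} _ → ⊥-elim (¬Fin0 (subst Fin eq i)))
                  , λ i _ → ⊥-elim (¬Fin0 (subst Fin eq i))

vertexless-≅ : ∀ {H G} → size H ≡ 0 → size G ≡ 0 → H ≅ G
vertexless-≅ {H} {G} eqH eqG = ≼⇒≅ {H} {G} (vertexless-≼ {H} G eqH) (trans eqH (≡-sym eqG))

Fin1-unique : ∀ {m} → m ≡ 1 → (i j : Fin m) → i ≡ j
Fin1-unique refl zero zero = refl

single-vertex-≼ : ∀ {H G} → size H ≡ 1 → Loopless H → Loopless G → Fin (size G) → H ≼ G
single-vertex-≼ {H} {G} eq H-loopless G-loopless v =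
  (λ _ → v) , (λ {i} {j} _ → Fin1-unique eq i j) , v-adj
  where
  v-adj : ∀ i j → adj H i j ≡ adj G v v
  v-adj i j = subst (λ j → adj H i j ≡ adj G v v) (Fin1-unique eq i j)
                    (trans (H-loopless i) (≡-sym (G-loopless v)))

single-vertex-≅ : ∀ {H G} → size H ≡ 1 → size G ≡ 1 → Loopless H → Loopless G → H ≅ G
single-vertex-≅ {H} {G} eqH eqG lH lG =
  ≼⇒≅ {H} {G} (single-vertex-≼ {H} {G} eqH lH lG (subst Fin (≡-sym eqG) zero))
              (trans eqH (≡-sym eqG))

K₁ : Graph
K₁ = record { size = 1 ; adj = λ _ _ → 0 ; sym = λ _ _ → refl }

K₁-≺ : ∀ {G} → Loopless G → 1 < size G → K₁ ≺ G
K₁-≺ {G} G-loopless 1<|G| =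
  ≼∧size<⇒≺ {K₁} {G}
    (single-vertex-≼ {K₁} {G} refl (λ _ → refl) G-loopless (fromℕ< (<⇒≤ 1<|G|))) 1<|G|

functions : ∀ k n → List (Fin k → Fin n)
functions zero    n = (λ ()) ∷ []
functions (suc k) n = concatMap (λ a → map (a Vector.∷_) (functions k n)) (allFin n)

functions-complete : ∀ {k n} (f : Fin k → Fin n) → Any (_≗ f) (functions k n)
functions-complete {zero} f = here λ ()
functions-complete {suc k} f =
  Any.concatMap⁺ _ (lose (∈-allFin (Vector.head f))
    (Any.map⁺ (Any.map cons-≗ (functions-complete (Vector.tail f)))))
  where
  cons-≗ : ∀ {g} → g ≗ Vector.tail f → (Vector.head f Vector.∷ g) ≗ f
  cons-≗ g≗ zero    = refl
  cons-≗ g≗ (suc i) = g≗ i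

∃-function? : ∀ {k n} {P : (Fin k → Fin n) → Set} →
  (∀ {f g} → f ≗ g → P f → P g) → (∀ f → Dec (P f)) → Dec (∃ P)
∃-function? {k} {n} resp P? =
  map′ (λ hit → Any.lookup hit , Any.lookup-result hit)
       (λ (f , Pf) → Any.map (λ g≗f → resp (≡-sym ∘ g≗f) Pf) (functions-complete f))
       (Any.any? P? (functions k n))

_≼?_ : Decidable _≼_
H ≼? G = ∃-function? respects embedding?
  where
  IsEmbedding : (Fin (size H) → Fin (size G)) → Set
  IsEmbedding f = Injective _≡_ _≡_ f × (∀ i j → adj H i j ≡ adj G (f i) (f j))
  respects : ∀ {f g} → f ≗ g → IsEmbedding f → IsEmbedding g
  respects {f} {g} f≗g (f-inj , f-adj) =
    (λ {x} {y} gx≡gy → f-inj (trans (f≗g x) (trans gx≡gy (≡-sym (f≗g y))))) ,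
    λ i j → trans (f-adj i j) (cong₂ (adj G) (f≗g i) (f≗g j))
  embedding? : ∀ f → Dec (IsEmbedding f)
  embedding? f =
    map′ (λ inj {x} {y} → inj x y) (λ inj x y → inj {x} {y})
         (all? λ x → all? λ y → (f x ≟ᶠ f y) →-dec (x ≟ᶠ y))
    ×-dec (all? λ i → all? λ j → adj H i j ≟ adj G (f i) (f j))

_≺?_ : Decidable _≺_
H ≺? G = (H ≼? G) ×-dec ¬? (G ≼? H)

_≅?_ : Decidable _≅_
H ≅? G with size H ≟ size G
... | no  |H|≢|G| = no λ H≅G → |H|≢|G| (≅⇒size≡ {H} {G} H≅G)
... | yes |H|≡|G| = map′ (λ H≼G → ≼⇒≅ {H} {G} H≼G |H|≡|G|) (≅⇒≼ {H} {G}) (H ≼? G)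

≅-decSetoid : DecSetoid _ _
≅-decSetoid = record
  { Carrier = Graph
  ; _≈_ = _≅_
  ; isDecEquivalence = record
    { isEquivalence = record
      { refl  = λ {G} → ≅-refl {G}
      ; sym   = λ {H} {G} → ≅-sym {H} {G}
      ; trans = λ {A} {B} {C} → ≅-trans {A} {B} {C}
      }
    ; _≟_ = _≅?_
    }
  }

inducedSubgraph : ∀ G {k} → (Fin k → Fin (size G)) → Graph
inducedSubgraph G {k} g = record
  { size = k ; adj = λ i j → adj G (g i) (g j) ; sym = λ i j → sym G (g i) (g j) }

candidates : Graph → List Graph
candidates G = concatMap (λ k → map (inducedSubgraph G) (functions k (size G))) (upTo (size G))

candidates-complete : ∀ {H G} → H ≺ G → Any (λ c → H ≅ c × c ≺ G) (candidates G)
candidates-complete {H} {G} H≺G@((f , f-inj , f-adj) , _) =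
  Any.concatMap⁺ _ (lose (∈-upTo⁺ (≺⇒size< {H} {G} H≺G))
    (Any.map⁺ (Any.map (λ {g} g≗f → H≅g g≗f , g≺G g≗f) (functions-complete f))))
  where
  H≅g : ∀ {g} → g ≗ f → H ≅ inducedSubgraph G g
  H≅g g≗f = (λ i → i) , ((λ eq → eq) , λ y → y , λ eq → eq) ,
            λ i j → trans (f-adj i j) (≡-sym (cong₂ (adj G) (g≗f i) (g≗f j)))
  g≺G : ∀ {g} → g ≗ f → inducedSubgraph G g ≺ G
  g≺G {g} g≗f = ≼∧size<⇒≺ {inducedSubgraph G g} {G}
    (g , (λ {x} {y} gx≡gy → f-inj (trans (≡-sym (g≗f x)) (trans gx≡gy (g≗f y)))) , λ _ _ → refl)
    (≺⇒size< {H} {G} H≺G)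

lowerClasses : Graph → List Graph
lowerClasses G = deduplicate _≅?_ (filter (_≺? G) (candidates G))

lowerClasses-strictLowerClasses : ∀ G → StrictLowerClasses G (lowerClasses G)
lowerClasses-strictLowerClasses G =
  All.deduplicate⁺ _≅?_ (All.all-filter (_≺? G) (candidates G)) ,
  Unique.deduplicate-! ≅-decSetoid _ ,
  λ H H≺G → Any.deduplicate⁺ _≅?_ (λ {x} {y} y≅x H≅x → ≅-trans {H} {x} {y} H≅x (≅-sym {y} {x} y≅x))
              (below H H≺G)
  where
  below : ∀ H → H ≺ G → Any (H ≅_) (filter (_≺? G) (candidates G))
  below H H≺G = [ Any.map proj₁ , contradiction (proj₂ (Any.lookup-result hit)) ]′
                  (Any.filter⁺ (_≺? G) hit)
    where hit = candidates-complete {H} {G} H≺G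

module _ {A : Set} {P Q : A → Set} (P? : ∀ x → Dec (P x)) {R : A → A → Set} where

  length-filter≤1 : ∀ {xs} → AllPairs (λ x y → ¬ R x y) xs → All Q xs →
                    (∀ {x y} → Q x → Q y → P x → P y → R x y) → length (filter P? xs) ≤ 1
  length-filter≤1 [] [] _ = z≤n
  length-filter≤1 {x ∷ xs} (x≁xs ∷ distinct) (Qx ∷ Qxs) P-related with P? x
  ... | no _ = length-filter≤1 distinct Qxs P-related
  ... | yes Px = s≤s (≤-reflexive (cong length (filter-none P? others)))
    where
    others : All (∁ P) xs
    others = All.zipWith (λ (x≁y , Qy) Py → x≁y (P-related Qx Qy Px Py)) (x≁xs , Qxs)

  length-filter≡1 : ∀ {xs} → AllPairs (λ x y → ¬ R x y) xs → All Q xs →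
                    (∀ {x y} → Q x → Q y → P x → P y → R x y) → Any P xs →
                    length (filter P? xs) ≡ 1
  length-filter≡1 distinct Qxs P-related hit =
    ≤-antisym (length-filter≤1 distinct Qxs P-related) (filter-some P? hit)

countOfSize : ℕ → List Graph → ℕ
countOfSize n L = length (filter ((_≟ n) ∘ size) L)

1+[i-j]≡[1+i]-j : ∀ i j → 1ℤ + (i - j) ≡ (1ℤ + i) - j
1+[i-j]≡[1+i]-j = solve-∀

-1+[i-j]≡i-[1+j] : ∀ i j → -1ℤ + (i - j) ≡ i - (1ℤ + j)
-1+[i-j]≡i-[1+j] = solve-∀

sumℤ-caseValue : ∀ L →
  sumℤ (map (caseValue ∘ size) L) ≡ + countOfSize 0 L - + countOfSize 1 L
sumℤ-caseValue [] = refl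
sumℤ-caseValue (K ∷ L) with size K
... | zero        = trans (cong (_+_ 1ℤ) (sumℤ-caseValue L))
                          (1+[i-j]≡[1+i]-j (+ countOfSize 0 L) (+ countOfSize 1 L))
... | suc zero    = trans (cong (_+_ -1ℤ) (sumℤ-caseValue L))
                          (-1+[i-j]≡i-[1+j] (+ countOfSize 0 L) (+ countOfSize 1 L))
... | suc (suc _) = trans (ℤ.+-identityˡ _) (sumℤ-caseValue L)

nullGraph-≺ : ∀ {G} → 0 < size G → nullGraph ≺ G
nullGraph-≺ {G} = ≼∧size<⇒≺ {nullGraph} {G} (vertexless-≼ {nullGraph} G refl)

K₁-strictLowerClasses : ∀ {X} → size X ≡ 0 → StrictLowerClasses K₁ (X ∷ [])
K₁-strictLowerClasses {X} eq =
  ≼∧size<⇒≺ {X} {K₁} (vertexless-≼ {X} K₁ eq) (≤-reflexive (cong suc eq)) ∷ [] ,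
  [] ∷ [] ,
  λ H H≺K₁ → here (vertexless-≅ {H} {X} (n<1⇒n≡0 (≺⇒size< {H} {K₁} H≺K₁)) eq)

module _ {G L} (classes : StrictLowerClasses G L) where

  private
    below = proj₁ classes
    distinct = proj₁ (proj₂ classes)
    complete = proj₂ (proj₂ classes)

  countOfSize0≡1 : 0 < size G → countOfSize 0 L ≡ 1
  countOfSize0≡1 0<|G| =
    length-filter≡1 ((_≟ 0) ∘ size) distinct below
      (λ {H} {K} _ _ → vertexless-≅ {H} {K})
      (Any.map (λ {K} ∅≅K → ≡-sym (≅⇒size≡ {nullGraph} {K} ∅≅K))
               (complete nullGraph (nullGraph-≺ {G} 0<|G|)))

  countOfSize1≡0 : size G ≡ 1 → countOfSize 1 L ≡ 0
  countOfSize1≡0 eq =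
    cong length (filter-none ((_≟ 1) ∘ size) (All.map (λ {K} → smaller {K}) below))
    where
    smaller : ∀ {K} → K ≺ G → size K ≢ 1
    smaller {K} K≺G |K|≡1 = 1+n≰n (subst₂ _<_ |K|≡1 eq (≺⇒size< {K} {G} K≺G))

  countOfSize1≡1 : 1 < size G → Loopless G → countOfSize 1 L ≡ 1
  countOfSize1≡1 1<|G| G-loopless =
    length-filter≡1 {Q = Loopless} ((_≟ 1) ∘ size) distinct
      (All.map (λ {K} K≺G → Loopless-≼ {K} {G} (proj₁ K≺G) G-loopless) below)
      (λ {H} {K} lH lK eqH eqK → single-vertex-≅ {H} {K} eqH eqK lH lK)
      (Any.map (λ {K} K₁≅K → ≡-sym (≅⇒size≡ {K₁} {K} K₁≅K))
               (complete K₁ (K₁-≺ {G} G-loopless 1<|G|)))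

module _ (μ : Graph → ℤ) (isMobius : IsMobiusFromNull μ) where

  open ≡-Reasoning

  private
    μ-null = proj₁ isMobius
    μ-rec = proj₂ isMobius

  -- The recursion pins μ down only at nullGraph itself; K₁ accepts any vertexless graph as its
  -- sole lower representative, which forces μ to agree on all of them.
  μ-vertexless : ∀ {X} → size X ≡ 0 → μ X ≡ 1ℤ
  μ-vertexless {X} eq = begin
    μ X                ≡⟨ ℤ.+-identityʳ (μ X) ⟨
    μ X + 0ℤ           ≡⟨ ℤ.neg-injective (trans (≡-sym (μ-K₁ eq)) (μ-K₁ refl)) ⟩
    μ nullGraph + 0ℤ   ≡⟨ ℤ.+-identityʳ (μ nullGraph) ⟩
    μ nullGraph        ≡⟨ μ-null ⟩
    1ℤ                 ∎
    where
    μ-K₁ : ∀ {Y} → size Y ≡ 0 → μ K₁ ≡ - (μ Y + 0ℤ)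
    μ-K₁ {Y} eqY = μ-rec K₁ (nullGraph-≺ {K₁} (s≤s z≤n)) (Y ∷ []) (K₁-strictLowerClasses {Y} eqY)

  μ-by-countOfSize1 : ∀ G → 0 < size G → (∀ K → K ≺ G → μ K ≡ caseValue (size K)) →
                      μ G ≡ - (1ℤ - + countOfSize 1 (lowerClasses G))
  μ-by-countOfSize1 G 0<|G| ih = begin
    μ G                               ≡⟨ μ-rec G (nullGraph-≺ {G} 0<|G|) L classes ⟩
    - sumℤ (map μ L)                  ≡⟨ cong (-_ ∘ sumℤ) (map-cong-local (All.map (ih _) below)) ⟩
    - sumℤ (map (caseValue ∘ size) L) ≡⟨ cong -_ (sumℤ-caseValue L) ⟩
    - (+ a₀ - + a₁)                   ≡⟨ cong (λ c → - (+ c - + a₁)) (countOfSize0≡1 {G} classes 0<|G|) ⟩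
    - (1ℤ - + a₁)                     ∎
    where
    L = lowerClasses G
    classes = lowerClasses-strictLowerClasses G
    below = proj₁ classes
    a₀ = countOfSize 0 L
    a₁ = countOfSize 1 L

  μ-loopless-positive : ∀ G s → size G ≡ suc s → Loopless G →
                        (∀ K → K ≺ G → μ K ≡ caseValue (size K)) → μ G ≡ caseValue (suc s)
  μ-loopless-positive G zero eq G-loopless ih =
    trans (μ-by-countOfSize1 G (≤-reflexive (≡-sym eq)) ih)
          (cong (λ c → - (1ℤ - + c)) (countOfSize1≡0 {G} (lowerClasses-strictLowerClasses G) eq))
  μ-loopless-positive G (suc s) eq G-loopless ih =
    trans (μ-by-countOfSize1 G (<-trans (s≤s z≤n) 1<|G|) ih)
          (cong (λ c → - (1ℤ - + c))
                (countOfSize1≡1 {G} (lowerClasses-strictLowerClasses G) 1<|G| G-loopless))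
    where
    1<|G| : 1 < size G
    1<|G| = subst (1 <_) (≡-sym eq) (s≤s (s≤s z≤n))

lemma3p7 : (μ : Graph → ℤ) → IsMobiusFromNull μ →
           (G : Graph) → Loopless G → μ G ≡ caseValue (size G)
lemma3p7 μ isMobius G G-loopless = <-rec P step (size G) G refl G-loopless
  where
  P : ℕ → Set
  P n = ∀ G → size G ≡ n → Loopless G → μ G ≡ caseValue n
  step : ∀ n → (∀ {m} → m < n → P m) → P n
  step zero    _  G eq _          = μ-vertexless μ isMobius {G} eq
  step (suc s) ih G eq G-loopless = μ-loopless-positive μ isMobius G s eq G-loopless below
    where
    below : ∀ K → K ≺ G → μ K ≡ caseValue (size K)
    below K K≺G = ih (subst (size K <_) eq (≺⇒size< {K} {G} K≺G)) K refl
                     (Loopless-≼ {K} {G} (proj₁ K≺G) G-loopless)
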